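{- Let $m$ be a positive integer and $C$ a self-orthogonal code of length $2m$ over $\mathbb{F}_5$. Then: (1) if $d_5^m\subset C$, then $C=d_5^m$; (2) if $(d_5^m)_0\subset C$ and $v_1\in C^\perp\setminus C$, then $C=(d_5^m)_0$ and $C+\mathbb{F}_5v_1=d_5^m$.
   Context: Codes over $\mathbb{F}_5$ are subspaces of $\mathbb{F}_5^n$ with the standard dot product; self-orthogonal means $C\subset C^\perp$. Let $d_5=\langle(1,2)\rangle\subset\mathbb{F}_5^2$, regard $d_5^m$ blockwise as a subspace of $\mathbb{F}_5^{2m}$, define $\bar{\cdot}:d_5\to\mathbb{F}_5$ by $a(1,2)\mapsto a$, and let $(d_5^m)_0=\{(x_1,\dots,x_m)\in d_5^m:\bar x_1+\cdots+\bar x_m=0\}$. Let $v_1=(1,2,0,\dots,0)\in\mathbb{F}_5^{2m}$. -}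

module Defs where

open import Data.Nat using (ℕ; zero; suc; _*_)
import Data.Nat as ℕ
open import Data.Nat.DivMod using (_%_; m%n<n)
open import Data.Fin using (Fin; toℕ; fromℕ<)
import Data.Fin
open import Data.Vec using (Vec; []; _∷_; map; zipWith; foldr; concat; replicate)
open import Data.Product using (Σ; ∃; _×_; _,_)
open import Relation.Binary.PropositionalEquality using (_≡_)
open import Relation.Nullary using (¬_)
open import Function.Bundles using (_⇔_)

F5 : Set
F5 = Fin 5

infixl 6 _+F_
infixl 7 _*F_

_+F_ : F5 → F5 → F5
a +F b = fromℕ< (m%n<n (toℕ a ℕ.+ toℕ b) 5)

_*F_ : F5 → F5 → F5
a *F b = fromℕ< (m%n<n (toℕ a ℕ.* toℕ b) 5)

0F 1F 2F : F5
0F = Data.Fin.zero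
1F = Data.Fin.suc Data.Fin.zero
2F = Data.Fin.suc (Data.Fin.suc Data.Fin.zero)

_+V_ : ∀ {n} → Vec F5 n → Vec F5 n → Vec F5 n
_+V_ = zipWith _+F_

_·V_ : ∀ {n} → F5 → Vec F5 n → Vec F5 n
a ·V x = map (a *F_) x

0V : ∀ {n} → Vec F5 n
0V = replicate _ 0F

sumF : ∀ {n} → Vec F5 n → F5
sumF = foldr _ _+F_ 0F

dot : ∀ {n} → Vec F5 n → Vec F5 n → F5
dot x y = sumF (zipWith _*F_ x y)

record Code (n : ℕ) : Set₁ where
  field
    mem      : Vec F5 n → Set
    zero-mem : mem 0V
    add-mem  : ∀ {x y} → mem x → mem y → mem (x +V y)
    scal-mem : ∀ a {x} → mem x → mem (a ·V x)
open Code public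

_∈⊥_ : ∀ {n} → Vec F5 n → Code n → Set
v ∈⊥ C = ∀ y → mem C y → dot v y ≡ 0F

SelfOrthogonal : ∀ {n} → Code n → Set
SelfOrthogonal C = ∀ x → mem C x → x ∈⊥ C

-- d₅ = ⟨(1,2)⟩, d₅^m blockwise inside F₅^{2m}; vectors of length 2m are
-- Vec F5 (m * 2), i.e. the concatenation of m blocks of length 2.

blk : F5 → Vec F5 2
blk a = a ∷ (a *F 2F) ∷ []

embed : ∀ {m} → Vec F5 m → Vec F5 (m * 2)
embed a = concat (map blk a)

InD5m : ∀ {m} → Vec F5 (m * 2) → Set
InD5m {m} x = Σ (Vec F5 m) λ a → x ≡ embed a

InD5m0 : ∀ {m} → Vec F5 (m * 2) → Set
InD5m0 {m} x = Σ (Vec F5 m) λ a → (x ≡ embed a) × (sumF a ≡ 0F)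

v1Blocks : ∀ m → Vec (Vec F5 2) m
v1Blocks zero    = []
v1Blocks (suc m) = (1F ∷ 2F ∷ []) ∷ replicate m (0F ∷ 0F ∷ [])

v1 : ∀ m → Vec F5 (m * 2)
v1 m = concat (v1Blocks m)

InSpanWith : ∀ {n} → Code n → Vec F5 n → Vec F5 n → Set
InSpanWith C v x = ∃ λ c → Σ F5 λ a → mem C c × (x ≡ c +V (a ·V v))

{-# OPTIONS --safe #-}
module Submission where

-- Pairing x ∈ F₅^{2m} with the element of d₅^m with coordinates u gives u · x̂, where
-- x̂ ∈ F₅^m lists the pairings of the blocks of x with (1,2). Since (1,2)·(1,2) = 5 = 0,
-- d₅ is its own orthogonal in F₅², so x̂ = 0 exactly when x ∈ d₅^m. In (1), for x ∈ C
-- self-orthogonality makes x̂ orthogonal to all of F₅^m, so C ⊆ d₅^m. In (2), x̂ is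
-- orthogonal to every vector with zero coordinate sum, hence constant, and its first
-- entry is v₁·x = 0; so again C ⊆ d₅^m. Finally d₅^m = (d₅^m)₀ ⊕ F₅v₁, so an element
-- of C with nonzero coordinate sum would put v₁ into C.

open import Defs
open import Data.Nat using (ℕ; zero; suc; _*_; _<_)
open import Data.Fin using (fromℕ)
open import Data.Fin.Properties using (all?; any?; _≟_)
open import Data.Vec using (Vec; []; _∷_; map; concat)
open import Data.Vec.Properties
  using (map-∘; map-cong; map-id; map-replicate; ∷-injectiveˡ; ∷-injectiveʳ)
open import Data.Product using (∃; _×_; _,_)
open import Data.Empty using (⊥-elim)
open import Function using (id)
open import Function.Bundles using (_⇔_; mk⇔)
open import Relation.Nullary using (¬_; Dec; yes; no)
open import Relation.Nullary.Decidable using (True; toWitness; ¬?; _→-dec_)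
open import Relation.Binary.PropositionalEquality
  using (_≡_; refl; sym; trans; cong; cong₂; subst; module ≡-Reasoning)
open ≡-Reasoning

-1F : F5
-1F = fromℕ 4

by-exhaustion₁ : {P : F5 → Set} (P? : ∀ a → Dec (P a)) → {True (all? P?)} → ∀ a → P a
by-exhaustion₁ P? {w} = toWitness w

by-exhaustion₂ : {P : F5 → F5 → Set} (P? : ∀ a b → Dec (P a b)) →
                 {True (all? λ a → all? λ b → P? a b)} → ∀ a b → P a b
by-exhaustion₂ P? {w} = toWitness w

by-exhaustion₃ : {P : F5 → F5 → F5 → Set} (P? : ∀ a b c → Dec (P a b c)) →
                 {True (all? λ a → all? λ b → all? λ c → P? a b c)} → ∀ a b c → P a b c
by-exhaustion₃ P? {w} = toWitness w

+F-identityˡ : ∀ a → 0F +F a ≡ a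
+F-identityˡ = by-exhaustion₁ λ a → 0F +F a ≟ a

+F-identityʳ : ∀ a → a +F 0F ≡ a
+F-identityʳ = by-exhaustion₁ λ a → a +F 0F ≟ a

+F-assoc : ∀ a b c → a +F (b +F c) ≡ (a +F b) +F c
+F-assoc = by-exhaustion₃ λ a b c → a +F (b +F c) ≟ (a +F b) +F c

-1F-inverseˡ : ∀ a → -1F *F a +F a ≡ 0F
-1F-inverseˡ = by-exhaustion₁ λ a → -1F *F a +F a ≟ 0F

+F-cancelˡ : ∀ a b → (a +F b) +F -1F *F a ≡ b
+F-cancelˡ = by-exhaustion₂ λ a b → (a +F b) +F -1F *F a ≟ b

*F-zeroˡ : ∀ a → 0F *F a ≡ 0F
*F-zeroˡ = by-exhaustion₁ λ a → 0F *F a ≟ 0F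

*F-zeroʳ : ∀ a → a *F 0F ≡ 0F
*F-zeroʳ = by-exhaustion₁ λ a → a *F 0F ≟ 0F

*F-identityˡ : ∀ a → 1F *F a ≡ a
*F-identityˡ = by-exhaustion₁ λ a → 1F *F a ≟ a

*F-assoc : ∀ a b c → a *F (b *F c) ≡ (a *F b) *F c
*F-assoc = by-exhaustion₃ λ a b c → a *F (b *F c) ≟ (a *F b) *F c

*F-distribʳ-+F : ∀ a b c → a *F c +F b *F c ≡ (a +F b) *F c
*F-distribʳ-+F = by-exhaustion₃ λ a b c → a *F c +F b *F c ≟ (a +F b) *F c

nonzero⇒invertible : ∀ s → ¬ s ≡ 0F → ∃ λ r → r *F s ≡ 1F
nonzero⇒invertible = by-exhaustion₁ λ s → ¬? (s ≟ 0F) →-dec any? λ r → r *F s ≟ 1F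

+V-identityʳ : ∀ {n} (x : Vec F5 n) → x +V 0V ≡ x
+V-identityʳ []      = refl
+V-identityʳ (a ∷ x) = cong₂ _∷_ (+F-identityʳ a) (+V-identityʳ x)

+V-cancelˡ : ∀ {n} (x y : Vec F5 n) → (x +V y) +V (-1F ·V x) ≡ y
+V-cancelˡ []      []      = refl
+V-cancelˡ (a ∷ x) (b ∷ y) = cong₂ _∷_ (+F-cancelˡ a b) (+V-cancelˡ x y)

·V-zeroʳ : ∀ {n} a → a ·V 0V {n} ≡ 0V
·V-zeroʳ {zero}  a = refl
·V-zeroʳ {suc n} a = cong₂ _∷_ (*F-zeroʳ a) (·V-zeroʳ a)

·V-cancel : ∀ {n} r s → r *F s ≡ 1F → (x : Vec F5 n) → r ·V (s ·V x) ≡ x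
·V-cancel r s rs≡1 x = begin
  map (r *F_) (map (s *F_) x)  ≡⟨ map-∘ (r *F_) (s *F_) x ⟨
  map (λ c → r *F (s *F c)) x  ≡⟨ map-cong cancel x ⟩
  map id x                     ≡⟨ map-id x ⟩
  x                            ∎
  where
  cancel : ∀ c → r *F (s *F c) ≡ c
  cancel c = trans (*F-assoc r s c) (trans (cong (_*F c) rs≡1) (*F-identityˡ c))

dot-zeroˡ : ∀ {n} (y : Vec F5 n) → dot 0V y ≡ 0F
dot-zeroˡ []      = refl
dot-zeroˡ (c ∷ y) rewrite dot-zeroˡ y | *F-zeroˡ c = refl

e₁ : ∀ {n} → Vec F5 (suc n)
e₁ = 1F ∷ 0V

dot-e₁ : ∀ {n} c (y : Vec F5 n) → dot e₁ (c ∷ y) ≡ c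
dot-e₁ c y rewrite dot-zeroˡ y | *F-identityˡ c = +F-identityʳ c

dot-zero-headˡ : ∀ {n} c (u y : Vec F5 n) → dot (0F ∷ u) (c ∷ y) ≡ dot u y
dot-zero-headˡ c u y rewrite *F-zeroˡ c = +F-identityˡ (dot u y)

dot-zero-headʳ : ∀ {n} a (u y : Vec F5 n) → dot (a ∷ u) (0F ∷ y) ≡ dot u y
dot-zero-headʳ a u y rewrite *F-zeroʳ a = +F-identityˡ (dot u y)

orthogonal⇒zero : ∀ {n} (y : Vec F5 n) → (∀ u → dot u y ≡ 0F) → y ≡ 0V
orthogonal⇒zero []      _   = refl
orthogonal⇒zero (c ∷ y) ⊥cy = cong₂ _∷_ c≡0 (orthogonal⇒zero y ⊥y)
  where
  c≡0 : c ≡ 0F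
  c≡0 = trans (sym (dot-e₁ c y)) (⊥cy e₁)
  ⊥y : ∀ u → dot u y ≡ 0F
  ⊥y u = trans (sym (dot-zero-headˡ c u y)) (⊥cy (0F ∷ u))

orthogonal-to-sum-zero⇒zero : ∀ {n} (y : Vec F5 (suc n)) → dot e₁ y ≡ 0F →
                              (∀ u → sumF u ≡ 0F → dot u y ≡ 0F) → y ≡ 0V
orthogonal-to-sum-zero⇒zero (c ∷ y) e₁⊥cy ⊥cy = cong₂ _∷_ c≡0 (orthogonal⇒zero y ⊥y)
  where
  c≡0 : c ≡ 0F
  c≡0 = trans (sym (dot-e₁ c y)) e₁⊥cy
  ⊥y : ∀ u → dot u y ≡ 0F
  ⊥y u = begin
    dot u y               ≡⟨ dot-zero-headʳ a u y ⟨
    dot (a ∷ u) (0F ∷ y)  ≡⟨ cong (λ c → dot (a ∷ u) (c ∷ y)) c≡0 ⟨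
    dot (a ∷ u) (c ∷ y)   ≡⟨ ⊥cy (a ∷ u) (-1F-inverseˡ (sumF u)) ⟩
    0F                    ∎
    where
    a : F5
    a = -1F *F sumF u

blockPairing : ∀ {m} → Vec F5 (m * 2) → Vec F5 m
blockPairing {zero}  []          = []
blockPairing {suc m} (a ∷ b ∷ x) = a +F 2F *F b ∷ blockPairing x

dot-embed : ∀ {m} (u : Vec F5 m) (x : Vec F5 (m * 2)) →
            dot (embed u) x ≡ dot u (blockPairing {m} x)
dot-embed []       []          = refl
dot-embed (c ∷ u) (a ∷ b ∷ x) = begin
  c *F a +F ((c *F 2F) *F b +F dot (embed u) x)
    ≡⟨ +F-assoc (c *F a) ((c *F 2F) *F b) (dot (embed u) x) ⟩
  (c *F a +F (c *F 2F) *F b) +F dot (embed u) x  ≡⟨ cong₂ _+F_ (pairing c a b) (dot-embed u x) ⟩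
  c *F (a +F 2F *F b) +F dot u (blockPairing x)  ∎
  where
  pairing : ∀ c a b → c *F a +F (c *F 2F) *F b ≡ c *F (a +F 2F *F b)
  pairing = by-exhaustion₃ λ c a b → c *F a +F (c *F 2F) *F b ≟ c *F (a +F 2F *F b)

d₅-self-dual : ∀ a b → a +F 2F *F b ≡ 0F → b ≡ a *F 2F
d₅-self-dual = by-exhaustion₂ λ a b → (a +F 2F *F b ≟ 0F) →-dec (b ≟ a *F 2F)

blockPairing≡0⇒InD5m : ∀ {m} (x : Vec F5 (m * 2)) → blockPairing {m} x ≡ 0V → InD5m {m} x
blockPairing≡0⇒InD5m {zero}  []          _  = [] , refl
blockPairing≡0⇒InD5m {suc m} (a ∷ b ∷ x) x̂≡0
  with blockPairing≡0⇒InD5m {m} x (∷-injectiveʳ x̂≡0)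
... | u , refl = a ∷ u , cong (λ b → a ∷ b ∷ embed u) (d₅-self-dual a b (∷-injectiveˡ x̂≡0))

embed-0V : ∀ {m} → embed (0V {m}) ≡ 0V
embed-0V {zero}  = refl
embed-0V {suc m} = cong (λ x → 0F ∷ 0F ∷ x) (embed-0V {m})

embed-+V : ∀ {m} (u w : Vec F5 m) → embed (u +V w) ≡ embed u +V embed w
embed-+V []      []      = refl
embed-+V (a ∷ u) (b ∷ w) =
  cong₂ (λ c x → a +F b ∷ c ∷ x) (sym (*F-distribʳ-+F a b 2F)) (embed-+V u w)

embed-·V : ∀ {m} c (u : Vec F5 m) → embed (c ·V u) ≡ c ·V embed u
embed-·V c []      = refl
embed-·V c (a ∷ u) = cong₂ (λ d x → c *F a ∷ d ∷ x) (sym (*F-assoc c a 2F)) (embed-·V c u)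

D5m : ∀ m → Code (m * 2)
D5m m = record
  { mem      = InD5m {m}
  ; zero-mem = 0V , sym (embed-0V {m})
  ; add-mem  = λ { (u , refl) (w , refl) → u +V w , sym (embed-+V u w) }
  ; scal-mem = λ { c (u , refl) → c ·V u , sym (embed-·V c u) }
  }

v1≡embed-e₁ : ∀ k → v1 (suc k) ≡ embed {suc k} e₁
v1≡embed-e₁ k = cong (λ xs → 1F ∷ 2F ∷ concat xs) (sym (map-replicate blk 0F k))

mem-summandʳ : ∀ {n} (C : Code n) {x y} → mem C (x +V y) → mem C x → mem C y
mem-summandʳ C {x} {y} cxy cx =
  subst (mem C) (+V-cancelˡ x y) (add-mem C cxy (scal-mem C -1F cx))

mem-unscale : ∀ {n} (C : Code n) {s x} → ¬ s ≡ 0F → mem C (s ·V x) → mem C x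
mem-unscale C {s} {x} s≢0 csx with nonzero⇒invertible s s≢0
... | r , rs≡1 = subst (mem C) (·V-cancel r s rs≡1 x) (scal-mem C r csx)

self-orthogonal⇒blockPairing-orthogonal : ∀ {m} (C : Code (m * 2)) → SelfOrthogonal C →
  ∀ {x} u → mem C x → mem C (embed u) → dot u (blockPairing {m} x) ≡ 0F
self-orthogonal⇒blockPairing-orthogonal C SO {x} u cx cu =
  trans (sym (dot-embed u x)) (SO (embed u) cu x cx)

D5m⊆C⇒C⊆D5m : ∀ {m} (C : Code (m * 2)) → SelfOrthogonal C →
  (∀ x → InD5m {m} x → mem C x) → ∀ x → mem C x → InD5m {m} x
D5m⊆C⇒C⊆D5m {m} C SO D⊆C x cx =
  blockPairing≡0⇒InD5m {m} x (orthogonal⇒zero (blockPairing x) λ u →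
    self-orthogonal⇒blockPairing-orthogonal C SO u cx (D⊆C (embed u) (u , refl)))

project₀ : ∀ {k} → Vec F5 (suc k) → Vec F5 (suc k)
project₀ (a ∷ u) = -1F *F sumF u ∷ u

sumF-project₀ : ∀ {k} (a : Vec F5 (suc k)) → sumF (project₀ a) ≡ 0F
sumF-project₀ (a ∷ u) = -1F-inverseˡ (sumF u)

decompose : ∀ {k} (a : Vec F5 (suc k)) → a ≡ project₀ a +V (sumF a ·V e₁)
decompose (a ∷ u) = cong₂ _∷_ (head-identity a (sumF u)) (sym tail-identity)
  where
  head-identity : ∀ a t → a ≡ -1F *F t +F (a +F t) *F 1F
  head-identity = by-exhaustion₂ λ a t → a ≟ -1F *F t +F (a +F t) *F 1F
  tail-identity : u +V (sumF (a ∷ u) ·V 0V) ≡ u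
  tail-identity = trans (cong (u +V_) (·V-zeroʳ (sumF (a ∷ u)))) (+V-identityʳ u)

embed-decompose : ∀ {k} (a : Vec F5 (suc k)) →
  embed a ≡ embed (project₀ a) +V (sumF a ·V v1 (suc k))
embed-decompose {k} a = begin
  embed a                           ≡⟨ cong embed (decompose a) ⟩
  embed (p +V (s ·V e₁ {k}))        ≡⟨ embed-+V p (s ·V e₁ {k}) ⟩
  embed p +V embed (s ·V e₁ {k})    ≡⟨ cong (embed p +V_) (embed-·V s (e₁ {k})) ⟩
  embed p +V (s ·V embed (e₁ {k}))  ≡⟨ cong (λ v → embed p +V (s ·V v)) (v1≡embed-e₁ k) ⟨
  embed p +V (s ·V v1 (suc k))      ∎
  where
  s : F5
  s = sumF a
  p : Vec F5 (suc k)
  p = project₀ a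

module _ {k} (C : Code (suc k * 2)) (D0⊆C : ∀ x → InD5m0 {suc k} x → mem C x) where

  D5m0⊆C⇒C⊆D5m : SelfOrthogonal C → v1 (suc k) ∈⊥ C → ∀ x → mem C x → InD5m {suc k} x
  D5m0⊆C⇒C⊆D5m SO v1⊥C x cx =
    blockPairing≡0⇒InD5m {suc k} x (orthogonal-to-sum-zero⇒zero x̂ e₁⊥x̂ sum-zero⊥x̂)
    where
    x̂ : Vec F5 (suc k)
    x̂ = blockPairing x
    e₁⊥x̂ : dot e₁ x̂ ≡ 0F
    e₁⊥x̂ = begin
      dot e₁ x̂                ≡⟨ dot-embed (e₁ {k}) x ⟨
      dot (embed (e₁ {k})) x  ≡⟨ cong (λ v → dot v x) (v1≡embed-e₁ k) ⟨
      dot (v1 (suc k)) x      ≡⟨ v1⊥C x cx ⟩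
      0F                      ∎
    sum-zero⊥x̂ : ∀ u → sumF u ≡ 0F → dot u x̂ ≡ 0F
    sum-zero⊥x̂ u Σu≡0 =
      self-orthogonal⇒blockPairing-orthogonal C SO u cx (D0⊆C (embed u) (u , refl , Σu≡0))

  embed-project₀∈C : ∀ a → mem C (embed (project₀ a))
  embed-project₀∈C a = D0⊆C (embed (project₀ a)) (project₀ a , refl , sumF-project₀ a)

  sumF·v1∈C : ∀ a → mem C (embed a) → mem C (sumF a ·V v1 (suc k))
  sumF·v1∈C a ca = mem-summandʳ C (subst (mem C) (embed-decompose a) ca) (embed-project₀∈C a)

  C⊆D5m⇒C⊆D5m0 : ¬ mem C (v1 (suc k)) → (∀ x → mem C x → InD5m {suc k} x) →
                  ∀ x → mem C x → InD5m0 {suc k} x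
  C⊆D5m⇒C⊆D5m0 v1∉C C⊆D x cx with C⊆D x cx
  ... | a , refl with sumF a ≟ 0F
  ...   | yes Σa≡0 = a , refl , Σa≡0
  ...   | no  Σa≢0 = ⊥-elim (v1∉C (mem-unscale C Σa≢0 (sumF·v1∈C a cx)))

  D5m⊆span : ∀ x → InD5m {suc k} x → InSpanWith C (v1 (suc k)) x
  D5m⊆span x (a , refl) =
    embed (project₀ a) , sumF a , embed-project₀∈C a , embed-decompose a

span⊆D5m : ∀ {m} (C : Code (m * 2)) {v} → (∀ x → mem C x → InD5m {m} x) → InD5m {m} v →
  ∀ x → InSpanWith C v x → InD5m {m} x
span⊆D5m {m} C C⊆D v∈D x (c , a , cc , refl) =
  add-mem (D5m m) (C⊆D c cc) (scal-mem (D5m m) a v∈D)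

proposition4p10 : (m : ℕ) → 0 < m → (C : Code (m * 2)) → SelfOrthogonal C →
    ((∀ x → InD5m {m} x → mem C x) → ∀ x → mem C x ⇔ InD5m {m} x)
    × ((∀ x → InD5m0 {m} x → mem C x) → v1 m ∈⊥ C → ¬ mem C (v1 m) →
        (∀ x → mem C x ⇔ InD5m0 {m} x) × (∀ x → InSpanWith C (v1 m) x ⇔ InD5m {m} x))
proposition4p10 (suc k) _ C SO =
    (λ D⊆C x → mk⇔ (D5m⊆C⇒C⊆D5m C SO D⊆C x) (D⊆C x))
  , λ D0⊆C v1⊥C v1∉C →
      let C⊆D = D5m0⊆C⇒C⊆D5m C D0⊆C SO v1⊥C
      in  (λ x → mk⇔ (C⊆D5m⇒C⊆D5m0 C D0⊆C v1∉C C⊆D x) (D0⊆C x))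
        , (λ x → mk⇔ (span⊆D5m C C⊆D (e₁ , v1≡embed-e₁ k) x) (D5m⊆span C D0⊆C x))
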